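{- Let $G$ be a connected bipartite graph on $n\geq 3$ vertices which does not have any twins of degree $2$ or greater, i.e. there is no pair of distinct vertices $u,v$, each of degree at least $2$, with $N(u)=N(v)$ or $N[u]=N[v]$. Then $\gamma^{\mathrm{ID}}(G)\leq \frac{n+\ell(G)}{2}$.
   Context: All graphs are finite, simple and undirected. $N(v)$ and $N[v]$ denote the open and closed neighbourhoods of $v$. A leaf is a vertex of degree $1$ and $\ell(G)$ is the number of leaves of $G$. A set $C\subseteq V(G)$ is an identifying code if for every vertex $v$ the set $N[v]\cap C$ is nonempty and for every two distinct vertices $u,v$ we have $N[u]\cap C\neq N[v]\cap C$. $\gamma^{\mathrm{ID}}(G)$ is the minimum size of an identifying code of $G$ (connected bipartite graphs on at least $3$ vertices admit one). -}

module Defs where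

open import Data.Nat using (ℕ; suc; _≟_; _≤_)
open import Data.Bool using (Bool; true; false)
open import Data.Fin using (Fin)
open import Data.Fin.Subset using (Subset; ∣_∣; _∩_; Nonempty; ⁅_⁆; _∪_)
open import Data.Vec using (tabulate)
open import Data.Product using (Σ; _×_)
open import Data.Sum using (_⊎_)
open import Relation.Nullary using (¬_)
open import Relation.Nullary.Decidable using (isYes)
open import Relation.Binary.PropositionalEquality using (_≡_; _≢_)

record Graph (n : ℕ) : Set where
  field
    adj   : Fin n → Fin n → Bool
    sym   : ∀ u v → adj u v ≡ adj v u
    irrefl : ∀ v → adj v v ≡ false

module _ {n : ℕ} (G : Graph n) where
  open Graph G

  N : Fin n → Subset n
  N v = tabulate (adj v)

  N[_] : Fin n → Subset n
  N[ v ] = N v ∪ ⁅ v ⁆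

  degree : Fin n → ℕ
  degree v = ∣ N v ∣

  leaves : ℕ
  leaves = ∣ tabulate (λ v → isYes (degree v ≟ 1)) ∣

  data Reachable : Fin n → Fin n → Set where
    here : ∀ {v} → Reachable v v
    step : ∀ {u w v} → adj u w ≡ true → Reachable w v → Reachable u v

  Connected : Set
  Connected = ∀ u v → Reachable u v

  Bipartite : Set
  Bipartite = Σ (Fin n → Bool) λ col → ∀ u v → adj u v ≡ true → col u ≢ col v

  NoTwinsDeg≥2 : Set
  NoTwinsDeg≥2 = ∀ u v → u ≢ v → 2 ≤ degree u → 2 ≤ degree v →
                 ¬ (N u ≡ N v ⊎ N[ u ] ≡ N[ v ])

  IdentifyingCode : Subset n → Set
  IdentifyingCode C =
    (∀ v → Nonempty (N[ v ] ∩ C)) ×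
    (∀ u v → u ≢ v → N[ u ] ∩ C ≢ N[ v ] ∩ C)

-- Fix a proper 2-colouring with sides A and B. Take all of A into the code, and
-- for every leaf b in B one further vertex of B: b itself if b has a sibling leaf
-- (another leaf with the same neighbour), and otherwise some other vertex at
-- distance two from b, which exists because G is connected with n ≥ 3. Vertices
-- of A are identified by themselves, a vertex of B with a neighbour other than a
-- is separated from a ∈ A by that neighbour, a leaf b of B hanging at a by the
-- vertex added for b, and two vertices of B either by a neighbour of one of them
-- or, if they are twins, hence sibling leaves, by the vertices themselves. Such
-- a code has at most |A| + ℓ(B) vertices; swapping the sides gives one with at
-- most |B| + ℓ(A), and the two bounds add up to n + ℓ(G).
module Submission where

open import Defs
open import Data.Nat using (ℕ; suc; _≤_; _<_; _+_; _*_; _≟_; _≤?_; z≤n; s≤s)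
open import Data.Nat.Properties
  using (≤-trans; ≤-reflexive; ≤-antisym; ≤-total; ≤-<-trans; <-irrefl; <⇒≱; ≤-pred; ≰⇒>; n≤1+n;
         +-mono-≤; +-monoʳ-≤; +-comm; +-suc; +-identityʳ; m+[n∸m]≡n;
         +-commutativeSemigroup)
open import Algebra.Properties.CommutativeSemigroup +-commutativeSemigroup using (interchange)
open import Data.Bool using (Bool; true; false; not)
open import Data.Bool.Properties using (¬-not; not-involutive; not-injective)
open import Data.Fin using (Fin; zero; suc)
open import Data.Fin.Properties using (any?) renaming (_≟_ to _≟ᶠ_)
open import Data.Fin.Subset
  using (Subset; inside; outside; _∈_; _∉_; _⊆_; _∩_; _∪_; ∁; ⁅_⁆; ⊥; ⊤; ∣_∣; Nonempty)
open import Data.Fin.Subset.Properties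
  using (_∈?_; drop-there; x∈p∪q⁺; x∈p∪q⁻; x∈p∩q⁺; x∈p∩q⁻; x∈⁅x⁆; x∈⁅y⁆⇒x≡y; x∉⁅y⁆⇒x≢y;
         ∣⁅x⁆∣≡1; ∣⊥∣≡0; ∣⊤∣≡n; ∣p∣≤n; ∣∁p∣≡n∸∣p∣; p⊆q⇒∣p∣≤∣q∣; ⊆-antisym;
         x∈p∧x≢y⇒x∈p-y; x∈p⇒∣p-x∣<∣p∣; x∉p⇒x∈∁p; ∪-∩-booleanAlgebra)
import Algebra.Lattice.Properties.BooleanAlgebra as BA
open import Data.Vec using ([]; _∷_; tabulate; here; there)
open import Data.Vec.Properties using (lookup∘tabulate; []=⇒lookup; lookup⇒[]=; tabulate-∘)
open import Data.Product using (Σ; ∃; _×_; _,_; proj₁; proj₂)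
open import Data.Sum using (_⊎_; inj₁; inj₂; [_,_]; swap)
open import Function using (_∘_)
open import Relation.Nullary using (¬_; yes; no; contradiction)
open import Relation.Nullary.Decidable
  using (Dec; isYes; isYes≗does; dec-true; decidable-stable; _×-dec_; ¬?)
open import Relation.Binary.PropositionalEquality
  using (_≡_; _≢_; refl; sym; trans; cong; cong₂; subst; module ≡-Reasoning)

∈-tabulate⁺ : ∀ {n} {f : Fin n → Bool} {x} → f x ≡ true → x ∈ tabulate f
∈-tabulate⁺ {f = f} {x} fx = lookup⇒[]= x (tabulate f) (trans (lookup∘tabulate f x) fx)

∈-tabulate⁻ : ∀ {n} {f : Fin n → Bool} {x} → x ∈ tabulate f → f x ≡ true
∈-tabulate⁻ {f = f} {x} x∈ = trans (sym (lookup∘tabulate f x)) ([]=⇒lookup x∈)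

∣p∪q∣≤∣p∣+∣q∣ : ∀ {n} (p q : Subset n) → ∣ p ∪ q ∣ ≤ ∣ p ∣ + ∣ q ∣
∣p∪q∣≤∣p∣+∣q∣ []            []            = z≤n
∣p∪q∣≤∣p∣+∣q∣ (outside ∷ p) (outside ∷ q) = ∣p∪q∣≤∣p∣+∣q∣ p q
∣p∪q∣≤∣p∣+∣q∣ (inside  ∷ p) (outside ∷ q) = s≤s (∣p∪q∣≤∣p∣+∣q∣ p q)
∣p∪q∣≤∣p∣+∣q∣ (outside ∷ p) (inside  ∷ q) =
  subst (suc ∣ p ∪ q ∣ ≤_) (sym (+-suc ∣ p ∣ ∣ q ∣)) (s≤s (∣p∪q∣≤∣p∣+∣q∣ p q))
∣p∪q∣≤∣p∣+∣q∣ (inside  ∷ p) (inside  ∷ q) =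
  s≤s (≤-trans (∣p∪q∣≤∣p∣+∣q∣ p q) (+-monoʳ-≤ ∣ p ∣ (n≤1+n ∣ q ∣)))

∣p∣+∣∁p∣≡n : ∀ {n} (p : Subset n) → ∣ p ∣ + ∣ ∁ p ∣ ≡ n
∣p∣+∣∁p∣≡n p = trans (cong (∣ p ∣ +_) (∣∁p∣≡n∸∣p∣ p)) (m+[n∸m]≡n (∣p∣≤n p))

∣p∩q∣+∣p∩∁q∣≡∣p∣ : ∀ {n} (p q : Subset n) → ∣ p ∩ q ∣ + ∣ p ∩ ∁ q ∣ ≡ ∣ p ∣
∣p∩q∣+∣p∩∁q∣≡∣p∣ []            []            = refl
∣p∩q∣+∣p∩∁q∣≡∣p∣ (outside ∷ p) (_       ∷ q) = ∣p∩q∣+∣p∩∁q∣≡∣p∣ p q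
∣p∩q∣+∣p∩∁q∣≡∣p∣ (inside  ∷ p) (inside  ∷ q) = cong suc (∣p∩q∣+∣p∩∁q∣≡∣p∣ p q)
∣p∩q∣+∣p∩∁q∣≡∣p∣ (inside  ∷ p) (outside ∷ q) =
  trans (+-suc ∣ p ∩ q ∣ ∣ p ∩ ∁ q ∣) (cong suc (∣p∩q∣+∣p∩∁q∣≡∣p∣ p q))

x∈p⇒0<∣p∣ : ∀ {n} {x : Fin n} {p} → x ∈ p → 0 < ∣ p ∣
x∈p⇒0<∣p∣ x∈p = ≤-<-trans z≤n (x∈p⇒∣p-x∣<∣p∣ x∈p)

∣p∣≡1⇒x≡y : ∀ {n} {x y : Fin n} {p} → ∣ p ∣ ≡ 1 → x ∈ p → y ∈ p → x ≡ y
∣p∣≡1⇒x≡y {x = x} {y} {p} ∣p∣≡1 x∈p y∈p with x ≟ᶠ y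
... | yes x≡y = x≡y
... | no  x≢y = contradiction (subst (1 <_) ∣p∣≡1 1<∣p∣) (<-irrefl refl)
  where
  1<∣p∣ : 1 < ∣ p ∣
  1<∣p∣ = ≤-<-trans (x∈p⇒0<∣p∣ (x∈p∧x≢y⇒x∈p-y y∈p (x≢y ∘ sym))) (x∈p⇒∣p-x∣<∣p∣ x∈p)

x∈p⊆⁅x⁆⇒∣p∣≡1 : ∀ {n} {x : Fin n} {p} → x ∈ p → p ⊆ ⁅ x ⁆ → ∣ p ∣ ≡ 1
x∈p⊆⁅x⁆⇒∣p∣≡1 {x = x} x∈p p⊆⁅x⁆ =
  ≤-antisym (≤-trans (p⊆q⇒∣p∣≤∣q∣ p⊆⁅x⁆) (≤-reflexive (∣⁅x⁆∣≡1 x))) (x∈p⇒0<∣p∣ x∈p)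

⊆-or-∃∉ : ∀ {n} (p q : Subset n) → p ⊆ q ⊎ ∃ λ x → x ∈ p × x ∉ q
⊆-or-∃∉ p q with any? (λ x → (x ∈? p) ×-dec ¬? (x ∈? q))
... | yes (x , x∈p , x∉q) = inj₂ (x , x∈p , x∉q)
... | no  ∄ = inj₁ λ {x} x∈p → decidable-stable (x ∈? q) (λ x∉q → ∄ (x , x∈p , x∉q))

∣p∣<n⇒∃∉ : ∀ {n} (p : Subset n) → ∣ p ∣ < n → ∃ λ x → x ∉ p
∣p∣<n⇒∃∉ (outside ∷ p) _         = zero , λ ()
∣p∣<n⇒∃∉ (inside  ∷ p) (s≤s ∣p∣<n) with ∣p∣<n⇒∃∉ p ∣p∣<n
... | x , x∉p = suc x , x∉p ∘ drop-there

image : ∀ {m k} → (Fin m → Fin k) → Subset m → Subset k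
image f []            = ⊥
image f (outside ∷ p) = image (f ∘ suc) p
image f (inside  ∷ p) = ⁅ f zero ⁆ ∪ image (f ∘ suc) p

∈-image : ∀ {m k} (f : Fin m → Fin k) {p x} → x ∈ p → f x ∈ image f p
∈-image f {inside  ∷ p} here         = x∈p∪q⁺ (inj₁ (x∈⁅x⁆ (f zero)))
∈-image f {outside ∷ p} (there x∈p) = ∈-image (f ∘ suc) x∈p
∈-image f {inside  ∷ p} (there x∈p) = x∈p∪q⁺ (inj₂ (∈-image (f ∘ suc) x∈p))

∣image∣≤∣p∣ : ∀ {m k} (f : Fin m → Fin k) (p : Subset m) → ∣ image f p ∣ ≤ ∣ p ∣
∣image∣≤∣p∣ {k = k} f [] = ≤-reflexive (∣⊥∣≡0 k)
∣image∣≤∣p∣ f (outside ∷ p) = ∣image∣≤∣p∣ (f ∘ suc) p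
∣image∣≤∣p∣ f (inside  ∷ p) =
  ≤-trans (∣p∪q∣≤∣p∣+∣q∣ ⁅ f zero ⁆ _)
          (+-mono-≤ (≤-reflexive (∣⁅x⁆∣≡1 (f zero))) (∣image∣≤∣p∣ (f ∘ suc) p))

module _ {n : ℕ} (G : Graph n) where
  open Graph G using (adj) renaming (sym to adj-sym; irrefl to adj-irrefl)

  ∈N⁺ : ∀ {v x} → adj v x ≡ true → x ∈ N G v
  ∈N⁺ = ∈-tabulate⁺

  ∈N⁻ : ∀ {v x} → x ∈ N G v → adj v x ≡ true
  ∈N⁻ = ∈-tabulate⁻

  N-sym : ∀ {v x} → x ∈ N G v → v ∈ N G x
  N-sym {v} {x} x∈Nv = ∈N⁺ (trans (adj-sym x v) (∈N⁻ x∈Nv))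

  v∉Nv : ∀ v → v ∉ N G v
  v∉Nv v v∈Nv with trans (sym (∈N⁻ v∈Nv)) (adj-irrefl v)
  ... | ()

  v∈N[v] : ∀ v → v ∈ N[_] G v
  v∈N[v] v = x∈p∪q⁺ (inj₂ (x∈⁅x⁆ v))

  N⊆N[] : ∀ {v x} → x ∈ N G v → x ∈ N[_] G v
  N⊆N[] x∈Nv = x∈p∪q⁺ (inj₁ x∈Nv)

  ∉N[] : ∀ {v x} → x ∉ N G v → x ≢ v → x ∉ N[_] G v
  ∉N[] {v} x∉Nv x≢v x∈N[v] with x∈p∪q⁻ (N G v) ⁅ v ⁆ x∈N[v]
  ... | inj₁ x∈Nv   = x∉Nv x∈Nv
  ... | inj₂ x∈⁅v⁆ = x≢v (x∈⁅y⁆⇒x≡y v x∈⁅v⁆)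

  Leaf : Fin n → Set
  Leaf v = degree G v ≡ 1

  Leaves : Subset n
  Leaves = tabulate (λ v → isYes (degree G v ≟ 1))

  leaf∈Leaves : ∀ {v} → Leaf v → v ∈ Leaves
  leaf∈Leaves {v} leaf =
    ∈-tabulate⁺ (trans (isYes≗does (degree G v ≟ 1)) (dec-true (degree G v ≟ 1) leaf))

  ClosedUnderAdjacency : Subset n → Set
  ClosedUnderAdjacency S = ∀ {x y} → x ∈ S → y ∈ N G x → y ∈ S

  reachable-preserves : ∀ {S u v} → ClosedUnderAdjacency S → Reachable G u v → u ∈ S → v ∈ S
  reachable-preserves closed here       u∈S = u∈S
  reachable-preserves closed (step e r) u∈S = reachable-preserves closed r (closed u∈S (∈N⁺ e))

  connected⇒n≤∣closed∣ : Connected G → ∀ {S x} → ClosedUnderAdjacency S → x ∈ S → n ≤ ∣ S ∣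
  connected⇒n≤∣closed∣ connected {S} {x} closed x∈S =
    subst (_≤ ∣ S ∣) (∣⊤∣≡n n)
          (p⊆q⇒∣p∣≤∣q∣ {p = ⊤} λ {y} _ → reachable-preserves closed (connected x y) x∈S)

  has-neighbour : 2 ≤ n → Connected G → ∀ v → ∃ λ x → x ∈ N G v
  has-neighbour 2≤n connected v with ∣p∣<n⇒∃∉ ⁅ v ⁆ (subst (_< n) (sym (∣⁅x⁆∣≡1 v)) 2≤n)
  ... | u , u∉⁅v⁆ = first-step (connected v u) (x∉⁅y⁆⇒x≢y u∉⁅v⁆)
    where
    first-step : ∀ {u} → Reachable G v u → u ≢ v → ∃ λ x → x ∈ N G v
    first-step here       u≢v = contradiction refl u≢v
    first-step (step e _) _   = _ , ∈N⁺ e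

  Sibling : Fin n → Fin n → Set
  Sibling b w = w ≢ b × ∃ λ x → x ∈ N G b × w ∈ N G x

  sibling? : ∀ b w → Dec (Sibling b w)
  sibling? b w = ¬? (w ≟ᶠ b) ×-dec any? (λ x → (x ∈? N G b) ×-dec (w ∈? N G x))

  sibling-sym : ∀ {b w} → Sibling b w → Sibling w b
  sibling-sym (w≢b , x , x∈Nb , w∈Nx) = w≢b ∘ sym , x , N-sym w∈Nx , N-sym x∈Nb

  sibling-of-leaf : ∀ {b u w} → Leaf b → u ∈ N G b → Sibling b w → w ∈ N G u
  sibling-of-leaf leaf u∈Nb (_ , x , x∈Nb , w∈Nx) =
    subst (λ y → _ ∈ N G y) (∣p∣≡1⇒x≡y leaf x∈Nb u∈Nb) w∈Nx

  -- Otherwise the edge at a leaf would be a whole component, against n ≥ 3.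
  leaf-has-sibling : 3 ≤ n → Connected G → ∀ {b u} → Leaf b → u ∈ N G b → ∃ (Sibling b)
  leaf-has-sibling 3≤n connected {b} {u} leaf u∈Nb
    with any? (λ w → ¬? (w ≟ᶠ b) ×-dec (w ∈? N G u))
  ... | yes (w , w≢b , w∈Nu) = w , w≢b , u , u∈Nb , w∈Nu
  ... | no  ∄ = contradiction (≤-trans n≤∣S∣ ∣S∣≤2) (<⇒≱ 3≤n)
    where
    S : Subset n
    S = ⁅ b ⁆ ∪ ⁅ u ⁆

    closed : ClosedUnderAdjacency S
    closed {x} {y} x∈S y∈Nx with x∈p∪q⁻ ⁅ b ⁆ ⁅ u ⁆ x∈S
    ... | inj₁ x∈⁅b⁆ = x∈p∪q⁺ (inj₂ (subst (_∈ ⁅ u ⁆) (∣p∣≡1⇒x≡y leaf u∈Nb y∈Nb) (x∈⁅x⁆ u)))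
      where
      y∈Nb : y ∈ N G b
      y∈Nb = subst (λ z → y ∈ N G z) (x∈⁅y⁆⇒x≡y b x∈⁅b⁆) y∈Nx
    ... | inj₂ x∈⁅u⁆ with y ≟ᶠ b
    ...   | yes refl = x∈p∪q⁺ (inj₁ (x∈⁅x⁆ b))
    ...   | no  y≢b  = contradiction (y , y≢b , subst (λ z → y ∈ N G z) (x∈⁅y⁆⇒x≡y u x∈⁅u⁆) y∈Nx) ∄

    n≤∣S∣ : n ≤ ∣ S ∣
    n≤∣S∣ = connected⇒n≤∣closed∣ connected closed (x∈p∪q⁺ (inj₁ (x∈⁅x⁆ b)))

    ∣S∣≤2 : ∣ S ∣ ≤ 2
    ∣S∣≤2 = ≤-trans (∣p∪q∣≤∣p∣+∣q∣ ⁅ b ⁆ ⁅ u ⁆)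
                    (+-mono-≤ (≤-reflexive (∣⁅x⁆∣≡1 b)) (≤-reflexive (∣⁅x⁆∣≡1 u)))

  twins-are-leaves : 2 ≤ n → Connected G → NoTwinsDeg≥2 G →
                     ∀ {u v} → u ≢ v → N G u ≡ N G v → Leaf u
  twins-are-leaves 2≤n connected twin-free {u} {v} u≢v twins with 2 ≤? degree G u
  ... | yes 2≤du = contradiction (inj₁ twins)
                     (twin-free u v u≢v 2≤du (subst (2 ≤_) (cong ∣_∣ twins) 2≤du))
  ... | no  2≰du = ≤-antisym (≤-pred (≰⇒> 2≰du))
                             (x∈p⇒0<∣p∣ (proj₂ (has-neighbour 2≤n connected u)))

  HasSiblingLeaf : Fin n → Set
  HasSiblingLeaf b = ∃ λ w → Sibling b w × Leaf w

  hasSiblingLeaf? : ∀ b → Dec (HasSiblingLeaf b)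
  hasSiblingLeaf? b = any? λ w → sibling? b w ×-dec (degree G w ≟ 1)

  -- The vertex added to the code on behalf of a leaf b; the final default is
  -- never used, by leaf-has-sibling.
  choose-partner : ∀ b → Dec (HasSiblingLeaf b) → Dec (∃ (Sibling b)) → Fin n
  choose-partner b (yes _) _             = b
  choose-partner b (no  _) (yes (w , _)) = w
  choose-partner b (no  _) (no  _)       = b

  partner : Fin n → Fin n
  partner b = choose-partner b (hasSiblingLeaf? b) (any? (sibling? b))

  partner-of-hasSiblingLeaf : ∀ {b} → HasSiblingLeaf b → partner b ≡ b
  partner-of-hasSiblingLeaf {b} h with hasSiblingLeaf? b
  ... | yes _  = refl
  ... | no  ¬h = contradiction h ¬h

  partner-sibling : ∀ {b} → ¬ HasSiblingLeaf b → ∃ (Sibling b) → Sibling b (partner b)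
  partner-sibling {b} ¬h s with hasSiblingLeaf? b | any? (sibling? b)
  ... | yes h | _               = contradiction h ¬h
  ... | no  _ | yes (_ , sib)  = sib
  ... | no  _ | no  ∄           = contradiction s ∄

module CodeFromColouring
  {n : ℕ} (G : Graph n) (3≤n : 3 ≤ n) (connected : Connected G) (twin-free : NoTwinsDeg≥2 G)
  (col : Fin n → Bool) (proper : ∀ u v → Graph.adj G u v ≡ true → col u ≢ col v)
  where

  A : Subset n
  A = tabulate col

  code : Subset n
  code = A ∪ image (partner G) (Leaves G ∩ ∁ A)

  ∣code∣≤ : ∣ code ∣ ≤ ∣ A ∣ + ∣ Leaves G ∩ ∁ A ∣
  ∣code∣≤ = ≤-trans (∣p∪q∣≤∣p∣+∣q∣ A _) (+-monoʳ-≤ ∣ A ∣ (∣image∣≤∣p∣ (partner G) (Leaves G ∩ ∁ A)))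

  2≤n : 2 ≤ n
  2≤n = ≤-trans (n≤1+n 2) 3≤n

  neighbour-colour : ∀ {v x} → x ∈ N G v → col x ≡ not (col v)
  neighbour-colour {v} {x} x∈Nv = ¬-not (proper x v (∈N⁻ G (N-sym G x∈Nv)))

  same-colour⇒∉N : ∀ {u x} → col x ≡ col u → x ∉ N G u
  same-colour⇒∉N {u} {x} eq x∈Nu = proper u x (∈N⁻ G x∈Nu) (sym eq)

  sibling-colour : ∀ {b w} → Sibling G b w → col w ≡ col b
  sibling-colour (_ , x , x∈Nb , w∈Nx) =
    trans (neighbour-colour w∈Nx) (trans (cong not (neighbour-colour x∈Nb)) (not-involutive _))

  A⊆code : ∀ {x} → col x ≡ true → x ∈ code
  A⊆code cx = x∈p∪q⁺ (inj₁ (∈-tabulate⁺ cx))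

  partner∈code : ∀ {b} → Leaf G b → col b ≡ false → partner G b ∈ code
  partner∈code {b} leaf cb =
    x∈p∪q⁺ (inj₂ (∈-image (partner G) (x∈p∩q⁺ (leaf∈Leaves G leaf , b∈∁A))))
    where
    b∈∁A : b ∈ ∁ A
    b∈∁A = x∉p⇒x∈∁p λ b∈A → contradiction (trans (sym (∈-tabulate⁻ b∈A)) cb) λ ()

  coded-sibling-of-leaf : ∀ {b u} → Leaf G b → col b ≡ false → u ∈ N G b →
                          ∃ λ w → w ∈ code × w ≢ b × w ∈ N G u
  coded-sibling-of-leaf {b} leaf cb u∈Nb with hasSiblingLeaf? G b
  ... | yes (w , sib , leaf-w) =
    w , subst (_∈ code) (partner-of-hasSiblingLeaf G (b , sibling-sym G sib , leaf))
                        (partner∈code leaf-w (trans (sibling-colour sib) cb))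
      , proj₁ sib , sibling-of-leaf G leaf u∈Nb sib
  ... | no ¬h =
    partner G b , partner∈code leaf cb , proj₁ sib , sibling-of-leaf G leaf u∈Nb sib
    where
    sib : Sibling G b (partner G b)
    sib = partner-sibling G ¬h (leaf-has-sibling G 3≤n connected leaf u∈Nb)

  Separates : Fin n → Fin n → Set
  Separates u v = ∃ λ w → w ∈ N[_] G u ∩ code × w ∉ N[_] G v

  separates⇒≢ : ∀ {u v} → Separates u v → N[_] G u ∩ code ≢ N[_] G v ∩ code
  separates⇒≢ {u} {v} (w , w∈u , w∉N[v]) eq =
    w∉N[v] (proj₁ (x∈p∩q⁻ (N[_] G v) code (subst (w ∈_) eq w∈u)))

  separate-A : ∀ {u v} → col u ≡ true → col v ≡ true → u ≢ v → Separates u v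
  separate-A cu cv u≢v =
    _ , x∈p∩q⁺ (v∈N[v] G _ , A⊆code cu) , ∉N[] G (same-colour⇒∉N (trans cu (sym cv))) u≢v

  separate-by-neighbour : ∀ {u v x} → col u ≡ false → col v ≡ false →
                          x ∈ N G u → x ∉ N G v → Separates u v
  separate-by-neighbour {u} cu cv x∈Nu x∉Nv =
    _ , x∈p∩q⁺ (N⊆N[] G x∈Nu , A⊆code (trans (neighbour-colour x∈Nu) (cong not cu)))
      , ∉N[] G x∉Nv λ x≡v → same-colour⇒∉N (trans cv (sym cu)) (subst (_∈ N G u) x≡v x∈Nu)

  separate-AB : ∀ {a b} → col a ≡ true → col b ≡ false → Separates b a ⊎ Separates a b
  separate-AB {a} {b} ca cb with ⊆-or-∃∉ (N G b) ⁅ a ⁆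
  ... | inj₂ (x , x∈Nb , x∉⁅a⁆) =
    inj₁ (x , x∈p∩q⁺ (N⊆N[] G x∈Nb , A⊆code cx)
            , ∉N[] G (same-colour⇒∉N (trans cx (sym ca))) (x∉⁅y⁆⇒x≢y x∉⁅a⁆))
    where
    cx : col x ≡ true
    cx = trans (neighbour-colour x∈Nb) (cong not cb)
  ... | inj₁ Nb⊆⁅a⁆ = inj₂ (by-coded-sibling (coded-sibling-of-leaf leaf cb a∈Nb))
    where
    a∈Nb : a ∈ N G b
    a∈Nb with has-neighbour G 2≤n connected b
    ... | x , x∈Nb = subst (_∈ N G b) (x∈⁅y⁆⇒x≡y a (Nb⊆⁅a⁆ x∈Nb)) x∈Nb

    leaf : Leaf G b
    leaf = x∈p⊆⁅x⁆⇒∣p∣≡1 a∈Nb Nb⊆⁅a⁆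

    by-coded-sibling : (∃ λ w → w ∈ code × w ≢ b × w ∈ N G a) → Separates a b
    by-coded-sibling (w , w∈code , w≢b , w∈Na) =
      w , x∈p∩q⁺ (N⊆N[] G w∈Na , w∈code) , ∉N[] G w∉Nb w≢b
      where
      w∉Nb : w ∉ N G b
      w∉Nb w∈Nb = v∉Nv G a (subst (_∈ N G a) (x∈⁅y⁆⇒x≡y a (Nb⊆⁅a⁆ w∈Nb)) w∈Na)

  separate-B : ∀ {u v} → col u ≡ false → col v ≡ false → u ≢ v → Separates u v ⊎ Separates v u
  separate-B {u} {v} cu cv u≢v with ⊆-or-∃∉ (N G u) (N G v) | ⊆-or-∃∉ (N G v) (N G u)
  ... | inj₂ (_ , x∈Nu , x∉Nv) | _ = inj₁ (separate-by-neighbour cu cv x∈Nu x∉Nv)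
  ... | _ | inj₂ (_ , x∈Nv , x∉Nu) = inj₂ (separate-by-neighbour cv cu x∈Nv x∉Nu)
  ... | inj₁ Nu⊆Nv | inj₁ Nv⊆Nu =
    inj₁ (u , x∈p∩q⁺ (v∈N[v] G u , u∈code) , ∉N[] G (same-colour⇒∉N (trans cu (sym cv))) u≢v)
    where
    twins : N G u ≡ N G v
    twins = ⊆-antisym Nu⊆Nv Nv⊆Nu

    sibling-leaf : HasSiblingLeaf G u
    sibling-leaf with has-neighbour G 2≤n connected u
    ... | x , x∈Nu =
      v , (u≢v ∘ sym , x , x∈Nu , N-sym G (subst (x ∈_) twins x∈Nu))
        , twins-are-leaves G 2≤n connected twin-free (u≢v ∘ sym) (sym twins)

    u∈code : u ∈ code
    u∈code = subst (_∈ code) (partner-of-hasSiblingLeaf G sibling-leaf)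
                   (partner∈code (twins-are-leaves G 2≤n connected twin-free u≢v twins) cu)

  separate : ∀ {u v} → u ≢ v → Separates u v ⊎ Separates v u
  separate {u} {v} u≢v with col u in cu | col v in cv
  ... | true  | true  = inj₁ (separate-A cu cv u≢v)
  ... | true  | false = swap (separate-AB cu cv)
  ... | false | true  = separate-AB cv cu
  ... | false | false = separate-B cu cv u≢v

  dominated : ∀ v → Nonempty (N[_] G v ∩ code)
  dominated v with col v in cv
  ... | true  = v , x∈p∩q⁺ (v∈N[v] G v , A⊆code cv)
  ... | false with has-neighbour G 2≤n connected v
  ...   | x , x∈Nv =
    x , x∈p∩q⁺ (N⊆N[] G x∈Nv , A⊆code (trans (neighbour-colour x∈Nv) (cong not cv)))

  code-identifying : IdentifyingCode G code
  code-identifying = dominated , λ u v u≢v →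
    [ separates⇒≢ , (λ s eq → separates⇒≢ s (sym eq)) ] (separate u≢v)

sides-bound : ∀ {n} (A L : Subset n) →
              (∣ A ∣ + ∣ L ∩ ∁ A ∣) + (∣ ∁ A ∣ + ∣ L ∩ ∁ (∁ A) ∣) ≡ n + ∣ L ∣
sides-bound {n} A L = begin
  (∣ A ∣ + ∣ L ∩ ∁ A ∣) + (∣ ∁ A ∣ + ∣ L ∩ ∁ (∁ A) ∣)
    ≡⟨ interchange ∣ A ∣ _ _ _ ⟩
  (∣ A ∣ + ∣ ∁ A ∣) + (∣ L ∩ ∁ A ∣ + ∣ L ∩ ∁ (∁ A) ∣)
    ≡⟨ cong₂ _+_ (∣p∣+∣∁p∣≡n A)
                 (cong (λ B → ∣ L ∩ ∁ A ∣ + ∣ L ∩ B ∣) (BA.¬-involutive (∪-∩-booleanAlgebra n) A)) ⟩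
  n + (∣ L ∩ ∁ A ∣ + ∣ L ∩ A ∣)
    ≡⟨ cong (n +_) (trans (+-comm ∣ L ∩ ∁ A ∣ _) (∣p∩q∣+∣p∩∁q∣≡∣p∣ L A)) ⟩
  n + ∣ L ∣ ∎
  where open ≡-Reasoning

2*m≤m+n : ∀ {m n} → m ≤ n → 2 * m ≤ m + n
2*m≤m+n {m} m≤n = +-monoʳ-≤ m (≤-trans (≤-reflexive (+-identityʳ m)) m≤n)

smaller-of-two : ∀ {n} {P : Subset n → Set} {t} (C D : Subset n) → P C → P D →
                 ∣ C ∣ + ∣ D ∣ ≤ t → ∃ λ E → P E × 2 * ∣ E ∣ ≤ t
smaller-of-two {t = t} C D PC PD ∣C∣+∣D∣≤t with ≤-total ∣ C ∣ ∣ D ∣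
... | inj₁ ∣C∣≤∣D∣ = C , PC , ≤-trans (2*m≤m+n ∣C∣≤∣D∣) ∣C∣+∣D∣≤t
... | inj₂ ∣D∣≤∣C∣ =
  D , PD , ≤-trans (2*m≤m+n ∣D∣≤∣C∣) (subst (_≤ t) (+-comm ∣ C ∣ ∣ D ∣) ∣C∣+∣D∣≤t)

theorem6 : (n : ℕ) (G : Graph n) → 3 ≤ n → Connected G → Bipartite G →
           NoTwinsDeg≥2 G →
           Σ (Subset n) λ C → IdentifyingCode G C × 2 * ∣ C ∣ ≤ n + leaves G
theorem6 n G 3≤n connected (col , proper) twin-free =
  smaller-of-two C₁.code C₂.code C₁.code-identifying C₂.code-identifying total
  where
  module C₁ = CodeFromColouring G 3≤n connected twin-free col proper
  module C₂ = CodeFromColouring G 3≤n connected twin-free (not ∘ col)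
                                (λ u v e → proper u v e ∘ not-injective)

  ∣C₂∣≤ : ∣ C₂.code ∣ ≤ ∣ ∁ C₁.A ∣ + ∣ Leaves G ∩ ∁ (∁ C₁.A) ∣
  ∣C₂∣≤ = subst (λ B → ∣ C₂.code ∣ ≤ ∣ B ∣ + ∣ Leaves G ∩ ∁ B ∣) (tabulate-∘ not col) C₂.∣code∣≤

  total : ∣ C₁.code ∣ + ∣ C₂.code ∣ ≤ n + leaves G
  total = ≤-trans (+-mono-≤ C₁.∣code∣≤ ∣C₂∣≤) (≤-reflexive (sides-bound C₁.A (Leaves G)))
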